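{- Let $n\ge 6$, and let $k\ge1$, $l\ge 2$ be integers with $k+l+3=n$. Then $F(G_{3,4}^{(n)}) > F(R_{k,l})$.
   Context: All graphs are finite and simple. The F-index of a graph $G$ is $F(G)=\sum_{v\in V(G)} d_G(v)^3$. Attaching a leaf to a vertex means adding a new vertex adjacent only to it. $G_{3,4}^{(n)}$ is obtained from a triangle $xyz$ by attaching $n-5$ leaves to $x$, one leaf to $y$ and one leaf to $z$. For $k,l\ge 1$, $R_{k,l}$ is obtained from a triangle $xyz$ by attaching $k$ pendant vertices to $z$ and then attaching $l$ new leaves to one of these pendant vertices; it has $k+l+3$ vertices. -}

module Defs where

open import Data.Nat using (ℕ; zero; suc; _+_; _*_; _∸_; _^_; _<ᵇ_; _≡ᵇ_)
open import Data.Bool using (Bool; true; false; _∧_; _∨_; not; if_then_else_)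
open import Data.Fin using (Fin; toℕ)
open import Data.List using (List; map; filter; length; allFin)
open import Data.Nat.ListAction using (sum)
open import Relation.Binary.PropositionalEquality using (_≡_)
open import Relation.Nullary.Decidable using (Dec; yes; no)
open import Data.Bool.Properties using () renaming (_≟_ to _≟ᵇ_)

record Graph (n : ℕ) : Set where
  field
    adj     : Fin n → Fin n → Bool
    symm    : ∀ u v → adj u v ≡ adj v u
    irrefl  : ∀ v → adj v v ≡ false
open Graph public

degree : ∀ {n} → Graph n → Fin n → ℕ
degree G v = length (filter (λ u → adj G v u ≟ᵇ true) (allFin _))

F-index : ∀ {n} → Graph n → ℕ
F-index G = sum (map (λ v → degree G v ^ 3) (allFin _))

_==_ : ℕ → ℕ → Bool
_==_ = _≡ᵇ_

inRange : ℕ → ℕ → ℕ → Bool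
inRange a b i = not (i <ᵇ a) ∧ (i <ᵇ b)

fromEdges : (n : ℕ) → (ℕ → ℕ → Bool) → Graph n
fromEdges n e = record
  { adj = λ u v → A (toℕ u) (toℕ v)
  ; symm = λ u v → sym' (toℕ u) (toℕ v)
  ; irrefl = λ v → irr (toℕ v) }
  where
  A : ℕ → ℕ → Bool
  A i j = not (i == j) ∧ (e i j ∨ e j i)
  ∨-comm' : ∀ a b → (a ∨ b) ≡ (b ∨ a)
  ∨-comm' false false = Relation.Binary.PropositionalEquality.refl
  ∨-comm' false true = Relation.Binary.PropositionalEquality.refl
  ∨-comm' true false = Relation.Binary.PropositionalEquality.refl
  ∨-comm' true true = Relation.Binary.PropositionalEquality.refl
  eqsym : ∀ i j → (i == j) ≡ (j == i)
  eqsym zero zero = Relation.Binary.PropositionalEquality.refl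
  eqsym zero (suc j) = Relation.Binary.PropositionalEquality.refl
  eqsym (suc i) zero = Relation.Binary.PropositionalEquality.refl
  eqsym (suc i) (suc j) = eqsym i j
  sym' : ∀ i j → A i j ≡ A j i
  sym' i j rewrite eqsym i j | ∨-comm' (e i j) (e j i) = Relation.Binary.PropositionalEquality.refl
  eqrefl : ∀ i → (i == i) ≡ true
  eqrefl zero = Relation.Binary.PropositionalEquality.refl
  eqrefl (suc i) = eqrefl i
  irr : ∀ i → A i i ≡ false
  irr i rewrite eqrefl i = Relation.Binary.PropositionalEquality.refl

-- G_{3,4}^{(n)}: triangle x=0,y=1,z=2; leaf 3 at y; leaf 4 at z;
-- leaves 5,…,n-1 at x  (n-5 of them).

triangle : ℕ → ℕ → Bool
triangle i j = (i == 0 ∧ j == 1) ∨ (i == 0 ∧ j == 2) ∨ (i == 1 ∧ j == 2)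

G34 : (n : ℕ) → Graph n
G34 n = fromEdges n (λ i j → triangle i j
                           ∨ (i == 1 ∧ j == 3)
                           ∨ (i == 2 ∧ j == 4)
                           ∨ (i == 0 ∧ inRange 5 n j))

-- R_{k,l}: triangle x=0,y=1,z=2; pendant vertices 3,…,k+2 at z;
-- leaves k+3,…,k+l+2 attached to the pendant vertex 3.  k+l+3 vertices.

R : (k l : ℕ) → Graph (k + l + 3)
R k l = fromEdges (k + l + 3) (λ i j → triangle i j
                                     ∨ (i == 2 ∧ inRange 3 (k + 3) j)
                                     ∨ (i == 3 ∧ inRange (k + 3) (k + l + 3) j))

-- Computing the
-- degrees gives, with n = 5 + j, k = 1 + a and l = 2 + b,
--   F(G₃,₄) = (2 + j)³ + 2·3³ + (2 + j)   and   F(R_{k,l}) = 2·2³ + (2 + k)³ + (1 + l)³ + (k − 1 + l),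
-- and the difference 12 + 18ab + 3a²b + 3ab² is positive.
module Submission where

open import Defs
open import Data.Nat using (ℕ; zero; suc; _+_; _*_; _^_; _≤_; _<_; _<ᵇ_; z≤n; s≤s; z<s)
open import Data.Nat.Properties
  using (+-assoc; +-comm; +-identityʳ; +-monoʳ-<; +-monoʳ-≤; ≤-trans; m≤m+n; m≤n+m; m<m+n; module ≤-Reasoning)
open import Data.Nat.Solver using (module +-*-Solver)
open import Data.Bool using (Bool; true; false; _∧_; _∨_; not; if_then_else_)
open import Data.Bool.Properties using (∧-zeroʳ) renaming (_≟_ to _≟ᵇ_)
open import Data.Fin using (Fin; toℕ)
import Data.Fin as Fin
open import Data.List using (map; filter; length; tabulate)
open import Data.Nat.ListAction using (sum)
open import Function using (_∘_; id)
open import Relation.Binary.PropositionalEquality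
  using (_≡_; refl; sym; trans; cong; cong₂; subst; module ≡-Reasoning)

count : ℕ → (ℕ → Bool) → ℕ
count zero    P = 0
count (suc n) P = (if P 0 then 1 else 0) + count n (P ∘ suc)

sumBelow : ℕ → (ℕ → ℕ) → ℕ
sumBelow zero    f = 0
sumBelow (suc n) f = f 0 + sumBelow n (f ∘ suc)

length-filter-tabulate : ∀ {m} n (g : Fin n → Fin m) (Q : Fin m → Bool) (P : ℕ → Bool) →
  (∀ i → Q (g i) ≡ P (toℕ i)) →
  length (filter (λ u → Q u ≟ᵇ true) (tabulate g)) ≡ count n P
length-filter-tabulate zero    g Q P Q≗P = refl
length-filter-tabulate (suc n) g Q P Q≗P with Q (g Fin.zero) | Q≗P Fin.zero
... | true  | eq rewrite sym eq =
  cong suc (length-filter-tabulate n (g ∘ Fin.suc) Q (P ∘ suc) (Q≗P ∘ Fin.suc))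
... | false | eq rewrite sym eq =
  length-filter-tabulate n (g ∘ Fin.suc) Q (P ∘ suc) (Q≗P ∘ Fin.suc)

sum-map-tabulate : ∀ {m} n (g : Fin n → Fin m) (F : Fin m → ℕ) (f : ℕ → ℕ) →
  (∀ i → F (g i) ≡ f (toℕ i)) →
  sum (map F (tabulate g)) ≡ sumBelow n f
sum-map-tabulate zero    g F f F≗f = refl
sum-map-tabulate (suc n) g F f F≗f =
  cong₂ _+_ (F≗f Fin.zero) (sum-map-tabulate n (g ∘ Fin.suc) F (f ∘ suc) (F≗f ∘ Fin.suc))

count-+ : ∀ a b P → count (a + b) P ≡ count a P + count b (λ i → P (a + i))
count-+ zero    b P = refl
count-+ (suc a) b P rewrite count-+ a b (P ∘ suc) = sym (+-assoc (if P 0 then 1 else 0) _ _)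

sumBelow-+ : ∀ a b f → sumBelow (a + b) f ≡ sumBelow a f + sumBelow b (λ i → f (a + i))
sumBelow-+ zero    b f = refl
sumBelow-+ (suc a) b f rewrite sumBelow-+ a b (f ∘ suc) = sym (+-assoc (f 0) _ _)

count-none : ∀ n P → (∀ i → i < n → P i ≡ false) → count n P ≡ 0
count-none zero    P none = refl
count-none (suc n) P none rewrite none 0 z<s =
  count-none n (P ∘ suc) (λ i i<n → none (suc i) (s≤s i<n))

count-all : ∀ n P → (∀ i → i < n → P i ≡ true) → count n P ≡ n
count-all zero    P all = refl
count-all (suc n) P all rewrite all 0 z<s =
  cong suc (count-all n (P ∘ suc) (λ i i<n → all (suc i) (s≤s i<n)))

sumBelow-const : ∀ n f c → (∀ i → i < n → f i ≡ c) → sumBelow n f ≡ n * c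
sumBelow-const zero    f c f≡c = refl
sumBelow-const (suc n) f c f≡c =
  cong₂ _+_ (f≡c 0 z<s) (sumBelow-const n (f ∘ suc) c (λ i i<n → f≡c (suc i) (s≤s i<n)))

<⇒<ᵇ≡true : ∀ m n → m < n → (m <ᵇ n) ≡ true
<⇒<ᵇ≡true zero    (suc n) _         = refl
<⇒<ᵇ≡true (suc m) (suc n) (s≤s m<n) = <⇒<ᵇ≡true m n m<n

≥⇒<ᵇ≡false : ∀ m n → n ≤ m → (m <ᵇ n) ≡ false
≥⇒<ᵇ≡false m       zero    _         = refl
≥⇒<ᵇ≡false (suc m) (suc n) (s≤s n≤m) = ≥⇒<ᵇ≡false m n n≤m

adjacent : (ℕ → ℕ → Bool) → ℕ → ℕ → Bool
adjacent e i j = not (i == j) ∧ (e i j ∨ e j i)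

F-index-fromEdges : ∀ n e → F-index (fromEdges n e) ≡ sumBelow n (λ i → count n (adjacent e i) ^ 3)
F-index-fromEdges n e = sum-map-tabulate n id _ _ λ i →
  cong (_^ 3) (length-filter-tabulate n id (adj (fromEdges n e) i) (adjacent e (toℕ i)) λ _ → refl)

g34Edges : ℕ → ℕ → ℕ → Bool
g34Edges n i j = triangle i j
               ∨ (i == 1 ∧ j == 3)
               ∨ (i == 2 ∧ j == 4)
               ∨ (i == 0 ∧ inRange 5 n j)

module G34-degrees (j : ℕ) where

  deg : ℕ → ℕ
  deg i = count (5 + j) (adjacent (g34Edges (5 + j)) i)

  deg-x : deg 0 ≡ 2 + j
  deg-x = cong (2 +_) (count-all j _ leaf-adjacent)
    where
    leaf-adjacent : ∀ t → t < j → adjacent (g34Edges (5 + j)) 0 (5 + t) ≡ true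
    leaf-adjacent t t<j rewrite <⇒<ᵇ≡true t j t<j = refl

  deg-y : deg 1 ≡ 3
  deg-y = cong (3 +_) (count-none j _ λ _ _ → refl)

  deg-z : deg 2 ≡ 3
  deg-z = cong (3 +_) (count-none j _ λ _ _ → refl)

  deg-leaf-y : deg 3 ≡ 1
  deg-leaf-y = cong (1 +_) (count-none j _ λ _ _ → refl)

  deg-leaf-z : deg 4 ≡ 1
  deg-leaf-z = cong (1 +_) (count-none j _ λ _ _ → refl)

  deg-leaf-x : ∀ t → t < j → deg (5 + t) ≡ 1
  deg-leaf-x t t<j rewrite <⇒<ᵇ≡true t j t<j =
    cong (1 +_) (count-none j _ λ u _ → ∧-zeroʳ (not (t == u)))

F-index-G34 : ∀ j → F-index (G34 (5 + j)) ≡ (2 + j) ^ 3 + 2 * 3 ^ 3 + (2 + j) * 1 ^ 3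
F-index-G34 j = begin
  F-index (G34 (5 + j))
    ≡⟨ F-index-fromEdges (5 + j) (g34Edges (5 + j)) ⟩
  deg 0 ^ 3 + (deg 1 ^ 3 + (deg 2 ^ 3 + (deg 3 ^ 3 + (deg 4 ^ 3 + sumBelow j (λ t → deg (5 + t) ^ 3)))))
    ≡⟨ cong₂ _+_ (cong (_^ 3) deg-x) (cong₂ _+_ (cong (_^ 3) deg-y) (cong₂ _+_ (cong (_^ 3) deg-z)
         (cong₂ _+_ (cong (_^ 3) deg-leaf-y) (cong₂ _+_ (cong (_^ 3) deg-leaf-z)
           (sumBelow-const j _ (1 ^ 3) λ t t<j → cong (_^ 3) (deg-leaf-x t t<j)))))) ⟩
  (2 + j) ^ 3 + (3 ^ 3 + (3 ^ 3 + (1 ^ 3 + (1 ^ 3 + j * 1 ^ 3))))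
    ≡⟨ regroup j ⟩
  (2 + j) ^ 3 + 2 * 3 ^ 3 + (2 + j) * 1 ^ 3 ∎
  where
  open ≡-Reasoning
  open G34-degrees j
  open +-*-Solver
  regroup : ∀ j → (2 + j) ^ 3 + (3 ^ 3 + (3 ^ 3 + (1 ^ 3 + (1 ^ 3 + j * 1 ^ 3))))
                ≡ (2 + j) ^ 3 + 2 * 3 ^ 3 + (2 + j) * 1 ^ 3
  regroup = solve 1 (λ j → (con 2 :+ j) :^ 3 :+ (con 3 :^ 3 :+ (con 3 :^ 3 :+ (con 1 :^ 3 :+ (con 1 :^ 3 :+ j :* con 1 :^ 3))))
                       := (con 2 :+ j) :^ 3 :+ con 2 :* con 3 :^ 3 :+ (con 2 :+ j) :* con 1 :^ 3) refl

rEdges : ℕ → ℕ → ℕ → ℕ → Bool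
rEdges k l i j = triangle i j
               ∨ (i == 2 ∧ inRange 3 (k + 3) j)
               ∨ (i == 3 ∧ inRange (k + 3) (k + l + 3) j)

-- Labels: triangle 0, 1, 2; the pendant vertex 3 carrying the l leaves;
-- the other pendant vertices 4 + t (t < a); the leaves 4 + (a + t) (t < l).
module R-degrees (a l : ℕ) where

  deg : ℕ → ℕ
  deg i = count (4 + (a + l)) (adjacent (rEdges (suc a) l) i)

  triangle<ᵇ : ∀ i → i < 3 → (i <ᵇ a + 3) ≡ true
  triangle<ᵇ i i<3 = <⇒<ᵇ≡true i (a + 3) (≤-trans i<3 (m≤n+m 3 a))

  pendant<ᵇ : ∀ t → t < a → (3 + t <ᵇ a + 3) ≡ true
  pendant<ᵇ t t<a = <⇒<ᵇ≡true (3 + t) (a + 3) (subst (3 + t <_) (+-comm 3 a) (+-monoʳ-< 3 t<a))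

  leaf≮ᵇ : ∀ t → (3 + (a + t) <ᵇ a + 3) ≡ false
  leaf≮ᵇ t = ≥⇒<ᵇ≡false (3 + (a + t)) (a + 3) (subst (_≤ 3 + (a + t)) (+-comm 3 a) (+-monoʳ-≤ 3 (m≤m+n a t)))

  leaf<ᵇ : ∀ t → t < l → (3 + (a + t) <ᵇ a + l + 3) ≡ true
  leaf<ᵇ t t<l = <⇒<ᵇ≡true (3 + (a + t)) (a + l + 3) (subst (3 + (a + t) <_) (+-comm 3 (a + l)) (+-monoʳ-< 3 (+-monoʳ-< a t<l)))

  deg-x : deg 0 ≡ 2
  deg-x = cong (2 +_) (count-none (a + l) _ λ _ _ → refl)

  deg-y : deg 1 ≡ 2
  deg-y rewrite triangle<ᵇ 0 z<s = cong (2 +_) (count-none (a + l) _ λ _ _ → refl)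

  deg-z : deg 2 ≡ 3 + a
  deg-z rewrite triangle<ᵇ 2 (s≤s (s≤s z<s)) = cong (3 +_) (begin
    count (a + l) _               ≡⟨ count-+ a l _ ⟩
    count a _ + count l _         ≡⟨ cong₂ _+_ (count-all a _ pendant) (count-none l _ leaf) ⟩
    a + 0                         ≡⟨ +-identityʳ a ⟩
    a                             ∎)
    where
    open ≡-Reasoning
    pendant : ∀ t → t < a → adjacent (rEdges (suc a) l) 2 (4 + t) ≡ true
    pendant t t<a rewrite pendant<ᵇ t t<a = refl
    leaf : ∀ t → t < l → adjacent (rEdges (suc a) l) 2 (4 + (a + t)) ≡ false
    leaf t _ rewrite leaf≮ᵇ t = refl

  deg-p : deg 3 ≡ 1 + l
  deg-p rewrite triangle<ᵇ 2 (s≤s (s≤s z<s)) | triangle<ᵇ 0 z<s | triangle<ᵇ 1 (s≤s z<s) =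
    cong (1 +_) (trans (count-+ a l _) (cong₂ _+_ (count-none a _ pendant) (count-all l _ leaf)))
    where
    pendant : ∀ t → t < a → adjacent (rEdges (suc a) l) 3 (4 + t) ≡ false
    pendant t t<a rewrite pendant<ᵇ t t<a = refl
    leaf : ∀ t → t < l → adjacent (rEdges (suc a) l) 3 (4 + (a + t)) ≡ true
    leaf t t<l rewrite leaf≮ᵇ t | leaf<ᵇ t t<l = refl

  deg-pendant : ∀ t → t < a → deg (4 + t) ≡ 1
  deg-pendant t t<a rewrite pendant<ᵇ t t<a =
    cong (1 +_) (count-none (a + l) _ λ u _ → ∧-zeroʳ (not (t == u)))

  deg-leaf : ∀ t → t < l → deg (4 + (a + t)) ≡ 1
  deg-leaf t t<l rewrite leaf≮ᵇ t | leaf<ᵇ t t<l =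
    cong (1 +_) (count-none (a + l) _ λ u _ → ∧-zeroʳ (not ((a + t) == u)))

F-index-R : ∀ a l → F-index (R (suc a) l) ≡ 2 * 2 ^ 3 + (3 + a) ^ 3 + (1 + l) ^ 3 + (a + l) * 1 ^ 3
F-index-R a l = begin
  F-index (R (suc a) l)
    ≡⟨ F-index-fromEdges (suc a + l + 3) (rEdges (suc a) l) ⟩
  sumBelow (suc a + l + 3) (λ i → count (suc a + l + 3) (adjacent (rEdges (suc a) l) i) ^ 3)
    ≡⟨ cong (λ N → sumBelow N (λ i → count N (adjacent (rEdges (suc a) l) i) ^ 3)) (cong suc (+-comm (a + l) 3)) ⟩
  deg 0 ^ 3 + (deg 1 ^ 3 + (deg 2 ^ 3 + (deg 3 ^ 3 + sumBelow (a + l) (λ t → deg (4 + t) ^ 3))))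
    ≡⟨ cong (λ s → deg 0 ^ 3 + (deg 1 ^ 3 + (deg 2 ^ 3 + (deg 3 ^ 3 + s)))) (sumBelow-+ a l _) ⟩
  deg 0 ^ 3 + (deg 1 ^ 3 + (deg 2 ^ 3 + (deg 3 ^ 3
    + (sumBelow a (λ t → deg (4 + t) ^ 3) + sumBelow l (λ t → deg (4 + (a + t)) ^ 3)))))
    ≡⟨ cong₂ _+_ (cong (_^ 3) deg-x) (cong₂ _+_ (cong (_^ 3) deg-y) (cong₂ _+_ (cong (_^ 3) deg-z)
         (cong₂ _+_ (cong (_^ 3) deg-p)
           (cong₂ _+_ (sumBelow-const a _ (1 ^ 3) λ t t<a → cong (_^ 3) (deg-pendant t t<a))
                      (sumBelow-const l _ (1 ^ 3) λ t t<l → cong (_^ 3) (deg-leaf t t<l)))))) ⟩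
  2 ^ 3 + (2 ^ 3 + ((3 + a) ^ 3 + ((1 + l) ^ 3 + (a * 1 ^ 3 + l * 1 ^ 3))))
    ≡⟨ regroup a l ⟩
  2 * 2 ^ 3 + (3 + a) ^ 3 + (1 + l) ^ 3 + (a + l) * 1 ^ 3 ∎
  where
  open ≡-Reasoning
  open R-degrees a l
  open +-*-Solver
  regroup : ∀ a l → 2 ^ 3 + (2 ^ 3 + ((3 + a) ^ 3 + ((1 + l) ^ 3 + (a * 1 ^ 3 + l * 1 ^ 3))))
                  ≡ 2 * 2 ^ 3 + (3 + a) ^ 3 + (1 + l) ^ 3 + (a + l) * 1 ^ 3
  regroup = solve 2 (λ a l →
      con 2 :^ 3 :+ (con 2 :^ 3 :+ ((con 3 :+ a) :^ 3 :+ ((con 1 :+ l) :^ 3 :+ (a :* con 1 :^ 3 :+ l :* con 1 :^ 3))))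
   := con 2 :* con 2 :^ 3 :+ (con 3 :+ a) :^ 3 :+ (con 1 :+ l) :^ 3 :+ (a :+ l) :* con 1 :^ 3) refl

-- With k = 1 + a, l = 2 + b and n = 5 + (1 + a + b).
F-index-gap : ∀ a b →
  2 * 2 ^ 3 + (3 + a) ^ 3 + (1 + (2 + b)) ^ 3 + (a + (2 + b)) * 1 ^ 3 + (12 + 18 * a * b + 3 * a * a * b + 3 * a * b * b)
    ≡ (2 + (1 + a + b)) ^ 3 + 2 * 3 ^ 3 + (2 + (1 + a + b)) * 1 ^ 3
F-index-gap = solve 2 (λ a b →
      con 2 :* con 2 :^ 3 :+ (con 3 :+ a) :^ 3 :+ (con 1 :+ (con 2 :+ b)) :^ 3 :+ (a :+ (con 2 :+ b)) :* con 1 :^ 3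
        :+ (con 12 :+ con 18 :* a :* b :+ con 3 :* a :* a :* b :+ con 3 :* a :* b :* b)
   := (con 2 :+ (con 1 :+ a :+ b)) :^ 3 :+ con 2 :* con 3 :^ 3 :+ (con 2 :+ (con 1 :+ a :+ b)) :* con 1 :^ 3) refl
  where open +-*-Solver

theorem9 : (n k l : ℕ) → 6 ≤ n → 1 ≤ k → 2 ≤ l → (eq : k + l + 3 ≡ n) →
    F-index (R k l) < F-index (G34 n)
theorem9 _ (suc a) (suc (suc b)) _ (s≤s z≤n) (s≤s (s≤s z≤n)) refl = begin-strict
  F-index (R (suc a) (2 + b))                   ≡⟨ F-index-R a (2 + b) ⟩
  F-R                                           <⟨ m<m+n F-R z<s ⟩
  F-R + (12 + 18 * a * b + 3 * a * a * b + 3 * a * b * b) ≡⟨ F-index-gap a b ⟩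
  F-G                                           ≡⟨ F-index-G34 (1 + a + b) ⟨
  F-index (G34 (5 + (1 + a + b)))               ≡⟨ cong (F-index ∘ G34) (vertex-count a b) ⟩
  F-index (G34 (suc a + suc (suc b) + 3))       ∎
  where
  open ≤-Reasoning
  open +-*-Solver
  F-R F-G : ℕ
  F-R = 2 * 2 ^ 3 + (3 + a) ^ 3 + (1 + (2 + b)) ^ 3 + (a + (2 + b)) * 1 ^ 3
  F-G = (2 + (1 + a + b)) ^ 3 + 2 * 3 ^ 3 + (2 + (1 + a + b)) * 1 ^ 3
  vertex-count : ∀ a b → 5 + (1 + a + b) ≡ suc a + suc (suc b) + 3
  vertex-count = solve 2 (λ a b → con 5 :+ (con 1 :+ a :+ b) := con 1 :+ a :+ (con 2 :+ b) :+ con 3) refl
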